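{- For any $t \in o(\sqrt{n})$, $\mathrm{IDMAT} \notin \mathrm{ACA}(t)$, where $\mathrm{IDMAT} = \{ w_k(0)\#w_k(1)\#\cdots\#w_k(k-1) \mid k\in\mathbb{N}_+\}$ over the alphabet $\{0,1,\#\}$ and $w_k(i) = 0^i 1 0^{k-i-1}$.
   Context: A cellular automaton (CA) is $C=(Q,\delta,\Sigma)$ with finite state set $Q$, local rule $\delta\colon Q^3\to Q$, input alphabet $\Sigma\subseteq Q$, and an inactive state $q\in Q\setminus\Sigma$ with $\delta(z_1,z_2,z_3)=q$ iff $z_2=q$; the global map is $\Delta(c)(z)=\delta(c(z-1),c(z),c(z+1))$ on $Q^{\mathbb{Z}}$. For input $w\in\Sigma^+$ the initial configuration has $c_0(i)=w(i)$ for $0\le i<|w|$ and $q$ elsewhere. An ACA additionally has a nonempty set $A\subseteq Q\setminus\{q\}$ of accept states and accepts $w$ if some $\Delta^\tau(c_0)$ has all cells in $A\cup\{q\}$; the least such $\tau$ is the acceptance time. $\mathrm{ACA}(t)$ is the class of languages $L(C)$ of ACAs accepting every $w\in L(C)$ within $t(|w|)$ steps. -}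

module Defs where

open import Data.Nat using (ℕ; zero; suc; _+_; _*_; _∸_; _≤_; _≥_)
open import Data.Integer as ℤ using (ℤ; +_; -[1+_])
open import Data.Fin using (Fin)
open import Data.List using (List; []; _∷_; length; replicate; _++_; intercalate; applyUpTo)
open import Data.Product using (Σ; ∃; _×_; _,_)
open import Data.Sum using (_⊎_)
open import Data.Empty using (⊥)
open import Function using (_∘_)
open import Function.Definitions using (Injective)
open import Relation.Binary.PropositionalEquality using (_≡_; _≢_)
open import Relation.Nullary using (¬_)
open import Relation.Unary using (Pred)
open import Level using (0ℓ)

data Sym : Set where
  s0 s1 s# : Sym

Word : Set
Word = List Sym

wk : ℕ → ℕ → Word
wk k i = replicate i s0 ++ (s1 ∷ replicate (k ∸ i ∸ 1) s0)

idmatWord : ℕ → Word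
idmatWord k = intercalate (s# ∷ []) (applyUpTo (wk k) k)

IDMAT : Pred Word 0ℓ
IDMAT w = Σ ℕ λ k → (k ≥ 1) × (w ≡ idmatWord k)

-- Cellular automaton with finite state set Fin n, input alphabet Sym embedded
-- injectively into the states, and an inactive state q outside the alphabet.
record ACA : Set₁ where
  field
    n      : ℕ
    δ      : Fin n → Fin n → Fin n → Fin n
    ι      : Sym → Fin n
    ι-inj  : Injective _≡_ _≡_ ι
    q      : Fin n
    q∉Σ    : ∀ a → ι a ≢ q
    inact  : ∀ z₁ z₂ z₃ → (δ z₁ z₂ z₃ ≡ q → z₂ ≡ q) × (z₂ ≡ q → δ z₁ z₂ z₃ ≡ q)
    A      : Pred (Fin n) 0ℓ
    A∌q    : ¬ A q
    A-ne   : Σ (Fin n) A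

  Config : Set
  Config = ℤ → Fin n

  Δ : Config → Config
  Δ c z = δ (c (z ℤ.- ℤ.+ 1)) (c z) (c (z ℤ.+ ℤ.+ 1))

  iterΔ : ℕ → Config → Config
  iterΔ zero    c = c
  iterΔ (suc m) c = Δ (iterΔ m c)

  cellAt : Word → ℕ → Fin n
  cellAt []      _       = q
  cellAt (a ∷ w) zero    = ι a
  cellAt (a ∷ w) (suc i) = cellAt w i

  init : Word → Config
  init w (+ i)    = cellAt w i
  init w -[1+ _ ] = q

  AllAccepting : Config → Set
  AllAccepting c = ∀ z → A (c z) ⊎ c z ≡ q

  AcceptsAt : Word → ℕ → Set
  AcceptsAt w τ = AllAccepting (iterΔ τ (init w))

  Lang : Pred Word 0ℓ
  Lang w = (length w ≥ 1) × Σ ℕ (AcceptsAt w)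

InACA : (ℕ → ℕ) → Pred Word 0ℓ → Set₁
InACA t L = Σ ACA λ C → let open ACA C in
  (∀ w → (Lang w → L w) × (L w → Lang w)) ×
  (∀ w → Lang w → Σ ℕ λ τ → (τ ≤ t (length w)) × AcceptsAt w τ)

-- t ∈ o(√n): for every c ≥ 1 there is N with c·t(n) ≤ √n, i.e. (c·t(n))² ≤ n, for all n ≥ N
LittleOSqrt : (ℕ → ℕ) → Set
LittleOSqrt t = ∀ c → c ≥ 1 → Σ ℕ λ N → ∀ m → m ≥ N → (c * t m) * (c * t m) ≤ m

-- In τ steps a cell of a cellular automaton sees only the input cells within
-- distance τ of it. Take an IDMAT word and, inside one row 0^j 1 0^(b+1), move
-- the 1 one cell to the right, where j > 2τ + 1 and b ≥ 2τ. A cell within distance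
-- τ + 1 of the change sees, in the new word, exactly what its left neighbour saw
-- in the old word, and every other cell sees nothing new; so acceptance at time
-- τ carries over to the new word. It has the same length, k(k+1) − 1, as the old
-- one, so it is not in IDMAT. For the row to be long enough it suffices that
-- 8 t(n) ≤ k, and n < (k+1)² makes this follow from t ∈ o(√n).

module Submission where

open import Data.Integer as ℤ using (+_; -[1+_]; ∣_∣; _⊖_)
import Data.Integer.Properties as ℤP
open import Data.Integer.Tactic.RingSolver using (solve-∀)
open import Data.List using (List; []; _∷_; [_]; length; replicate; _++_; intercalate)
open import Data.List.Properties
  using ( length-++; length-++-≤ʳ; length-replicate; length-applyUpTo
        ; ++-assoc; ++-identityʳ; ++-cancelˡ; ∷-injectiveˡ)
open import Data.List.Membership.Propositional.Properties using (∈-applyUpTo⁺; ∈-∃++)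
open import Data.List.Relation.Unary.All using (All; []; _∷_)
open import Data.List.Relation.Unary.All.Properties using (applyUpTo⁺₁)
open import Data.Nat as ℕ using (ℕ; zero; suc; _+_; _*_; _∸_; _≤_; _<_; _≤?_; s≤s; s≤s⁻¹; z≤n; z<s)
open import Data.Nat.Properties
import Data.Nat.Tactic.RingSolver as ℕ-Ring
open import Data.Product using (∃; ∃₂; _×_; _,_; proj₁; proj₂)
open import Data.Sum using (_⊎_)
open import Function using (_∘_)
open import Relation.Binary.PropositionalEquality hiding ([_])
open import Relation.Nullary using (¬_; yes; no; contradiction)
open import Relation.Binary.Definitions using (tri<; tri≈; tri>)
open import Defs

∣m⊖n∣≡∣m-n∣ : ∀ m n → ∣ m ⊖ n ∣ ≡ ℕ.∣ m - n ∣
∣m⊖n∣≡∣m-n∣ zero    zero    = refl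
∣m⊖n∣≡∣m-n∣ zero    (suc n) = refl
∣m⊖n∣≡∣m-n∣ (suc m) zero    = refl
∣m⊖n∣≡∣m-n∣ (suc m) (suc n) = trans (cong ∣_∣ (ℤP.[1+m]⊖[1+n]≡m⊖n m n)) (∣m⊖n∣≡∣m-n∣ m n)

∣+m-+n∣≡∣m-n∣ : ∀ m n → ∣ + m ℤ.- + n ∣ ≡ ℕ.∣ m - n ∣
∣+m-+n∣≡∣m-n∣ m n = trans (cong ∣_∣ (ℤP.m-n≡m⊖n m n)) (∣m⊖n∣≡∣m-n∣ m n)

∣1+n-n∣≡1 : ∀ n → ℕ.∣ suc n - n ∣ ≡ 1
∣1+n-n∣≡1 zero    = refl
∣1+n-n∣≡1 (suc n) = ∣1+n-n∣≡1 n

1<∣m-n∣⇒m≢n : ∀ {m n} → 1 < ℕ.∣ m - n ∣ → m ≢ n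
1<∣m-n∣⇒m≢n {n = n} gap refl = n≮0 (subst (1 <_) (∣n-n∣≡0 n) gap)

1<∣m-n∣⇒m≢1+n : ∀ {m n} → 1 < ℕ.∣ m - n ∣ → m ≢ suc n
1<∣m-n∣⇒m≢1+n {n = n} gap refl = <-irrefl refl (subst (1 <_) (∣1+n-n∣≡1 n) gap)

∣1+i-[p+j]∣≤ρ⇒i≡p+r : ∀ {p j b ρ} i → ρ < j → ρ ≤ suc b → ℕ.∣ suc i - (p + j) ∣ ≤ ρ →
                ∃ λ r → r ≤ j + b × p + r ≡ i
∣1+i-[p+j]∣≤ρ⇒i≡p+r {p} {j} {b} {ρ} i ρ<j ρ≤1+b close =
  let r , p+r≡i = m≤n⇒∃[o]m+o≡n p≤i
  in r , +-cancelˡ-≤ p _ _ (subst (_≤ p + (j + b)) (sym p+r≡i) i≤p+[j+b]) , p+r≡i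
  where
  open ≤-Reasoning
  p≤i : p ≤ i
  p≤i = s≤s⁻¹ (+-cancelʳ-< j p (suc i) (begin-strict
    p + j                          ≤⟨ m≤n+∣n-m∣ (p + j) (suc i) ⟩
    suc i + ℕ.∣ suc i - (p + j) ∣  ≤⟨ +-monoʳ-≤ (suc i) close ⟩
    suc i + ρ                      <⟨ +-monoʳ-< (suc i) ρ<j ⟩
    suc i + j                      ∎))
  i≤p+[j+b] : i ≤ p + (j + b)
  i≤p+[j+b] = s≤s⁻¹ (begin
    suc i                          ≤⟨ m≤n+∣m-n∣ (suc i) (p + j) ⟩
    p + j + ℕ.∣ suc i - (p + j) ∣  ≤⟨ +-monoʳ-≤ (p + j) (≤-trans close ρ≤1+b) ⟩
    p + j + suc b                  ≡⟨ +-suc (p + j) b ⟩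
    suc (p + j + b)                ≡⟨ cong suc (+-assoc p j b) ⟩
    suc (p + (j + b))              ∎)

∣[z+d]-p∣≤∣z-p∣+∣d∣ : ∀ z d p → ∣ (z ℤ.+ d) ℤ.- p ∣ ≤ ∣ z ℤ.- p ∣ + ∣ d ∣
∣[z+d]-p∣≤∣z-p∣+∣d∣ z d p =
  subst (λ x → ∣ x ∣ ≤ ∣ z ℤ.- p ∣ + ∣ d ∣) (regroup z d p) (ℤP.∣i+j∣≤∣i∣+∣j∣ (z ℤ.- p) d)
  where
  regroup : ∀ z d p → (z ℤ.- p) ℤ.+ d ≡ (z ℤ.+ d) ℤ.- p
  regroup = solve-∀

∣z-p∣≤∣[z+d]-p∣+∣d∣ : ∀ z d p → ∣ z ℤ.- p ∣ ≤ ∣ (z ℤ.+ d) ℤ.- p ∣ + ∣ d ∣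
∣z-p∣≤∣[z+d]-p∣+∣d∣ z d p =
  subst₂ (λ x n → ∣ x ∣ ≤ ∣ (z ℤ.+ d) ℤ.- p ∣ + n) (regroup z d p) (ℤP.∣-i∣≡∣i∣ d)
    (ℤP.∣i+j∣≤∣i∣+∣j∣ ((z ℤ.+ d) ℤ.- p) (ℤ.- d))
  where
  regroup : ∀ z d p → ((z ℤ.+ d) ℤ.- p) ℤ.+ ℤ.- d ≡ z ℤ.- p
  regroup = solve-∀

m*[1+m]≡n*[1+n]⇒m≡n : ∀ {m n} → m * suc m ≡ n * suc n → m ≡ n
m*[1+m]≡n*[1+n]⇒m≡n {m} {n} eq with <-cmp m n
... | tri< m<n _ _ = contradiction eq (<⇒≢ (*-mono-< m<n (s≤s m<n)))
... | tri≈ _ m≡n _ = m≡n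
... | tri> _ _ n<m = contradiction (sym eq) (<⇒≢ (*-mono-< n<m (s≤s n<m)))

m*m<n*[1+n]⇒m≤n : ∀ {m n} → m * m < n * suc n → m ≤ n
m*m<n*[1+n]⇒m≤n m*m< = ≮⇒≥ λ n<m → <⇒≱ m*m< (*-mono-≤ (<⇒≤ n<m) n<m)

8*m≤n⇒n≡2+2m+2+o : ∀ m n → 8 * m ≤ n → 8 ≤ n →
                   ∃ λ o → m + m ≤ o × n ≡ suc (suc (m + m)) + suc (suc o)
8*m≤n⇒n≡2+2m+2+o m n 8m≤n 8≤n =
  let o , 4m+4+o≡n = m≤n⇒∃[o]m+o≡n 4m+4≤n
  in m + m + o , m≤m+n (m + m) o , sym (trans (regroup m o) 4m+4+o≡n)
  where
  double : ∀ m → 2 * (4 * m + 4) ≡ 8 * m + 8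
  double = ℕ-Ring.solve-∀
  regroup : ∀ m o → suc (suc (m + m)) + suc (suc (m + m + o)) ≡ 4 * m + 4 + o
  regroup = ℕ-Ring.solve-∀
  4m+4≤n : 4 * m + 4 ≤ n
  4m+4≤n = *-cancelˡ-≤ 2 (begin
    2 * (4 * m + 4)  ≡⟨ double m ⟩
    8 * m + 8        ≤⟨ +-mono-≤ 8m≤n 8≤n ⟩
    n + n            ≡⟨ cong (_+_ n) (+-identityʳ n) ⟨
    2 * n            ∎)
    where open ≤-Reasoning

padded : Word → ℕ → Sym → Sym → ℕ → Word → Word
padded U j x y b V = U ++ replicate j s0 ++ x ∷ y ∷ replicate b s0 ++ V

padded-length : ∀ U j x y x′ y′ b V → length (padded U j x y b V) ≡ length (padded U j x′ y′ b V)
padded-length U j x y x′ y′ b V =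
  trans (length-++ U) (trans (cong (_+_ (length U)) (trans (length-++ R) (sym (length-++ R)))) (sym (length-++ U)))
  where R = replicate j s0

padded-nonempty : ∀ U j x y b V → 1 ≤ length (padded U j x y b V)
padded-nonempty U j x y b V =
  ≤-trans (s≤s z≤n) (≤-trans (length-++-≤ʳ (x ∷ y ∷ _) {replicate j s0}) (length-++-≤ʳ _ {U}))

padded-injective : ∀ U j {x y x′ y′} b V → padded U j x y b V ≡ padded U j x′ y′ b V → x ≡ x′
padded-injective U j b V eq = ∷-injectiveˡ (++-cancelˡ (replicate j s0) _ _ (++-cancelˡ U _ _ eq))

module _ {A : Set} (s : List A) where
  private
    prepend-split : ∀ x {T y : List A} → (∃₂ λ U V → T ≡ U ++ y ++ V) →
                    ∃₂ λ U V → x ++ s ++ T ≡ U ++ y ++ V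
    prepend-split x {T} {y} (U , V , T≡U++y++V) = x ++ s ++ U , V , (begin
      x ++ s ++ T               ≡⟨ cong (λ W → x ++ s ++ W) T≡U++y++V ⟩
      x ++ s ++ U ++ y ++ V     ≡⟨ cong (x ++_) (++-assoc s U _) ⟨
      x ++ (s ++ U) ++ y ++ V   ≡⟨ ++-assoc x (s ++ U) _ ⟨
      (x ++ s ++ U) ++ y ++ V   ∎)
      where open ≡-Reasoning

  intercalate-split : ∀ xs y ys → ∃₂ λ U V → intercalate s (xs ++ y ∷ ys) ≡ U ++ y ++ V
  intercalate-split []            y []      = [] , [] , sym (++-identityʳ y)
  intercalate-split []            y (_ ∷ _) = [] , _ , refl
  intercalate-split (x ∷ [])      y ys      = prepend-split x (intercalate-split [] y ys)
  intercalate-split (x ∷ x′ ∷ xs) y ys      = prepend-split x (intercalate-split (x′ ∷ xs) y ys)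

  length-intercalate : ∀ m x xs → All (λ y → length y ≡ m) (x ∷ xs) →
                       length s + length (intercalate s (x ∷ xs)) ≡ suc (length xs) * (length s + m)
  length-intercalate m x []       (|x| ∷ [])   = trans (cong (_+_ (length s)) |x|) (sym (+-identityʳ _))
  length-intercalate m x (y ∷ ys) (|x| ∷ |ys|) = begin
    length s + length (x ++ s ++ I)
      ≡⟨ cong (_+_ (length s)) (trans (length-++ x) (cong (_+_ (length x)) (length-++ s))) ⟩
    length s + (length x + (length s + length I))
      ≡⟨ +-assoc (length s) (length x) _ ⟨
    (length s + length x) + (length s + length I)
      ≡⟨ cong₂ _+_ (cong (_+_ (length s)) |x|) (length-intercalate m y ys |ys|) ⟩
    (length s + m) + suc (length ys) * (length s + m)
      ∎
    where
    open ≡-Reasoning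
    I = intercalate s (y ∷ ys)

length-wk : ∀ {k i} → i < k → length (wk k i) ≡ k
length-wk {suc k} {zero}  _         = cong suc (length-replicate k)
length-wk {suc k} {suc i} (s≤s i<k) = cong suc (length-wk i<k)

idmatWord-length : ∀ k → suc (length (idmatWord (suc k))) ≡ suc k * suc (suc k)
idmatWord-length k =
  trans (length-intercalate [ s# ] (suc k) _ _ (applyUpTo⁺₁ (wk (suc k)) (suc k) length-wk))
        (cong (λ n → suc n * suc (suc k)) (length-applyUpTo _ k))

idmatWord-length-injective : ∀ {m n} → length (idmatWord (suc m)) ≡ length (idmatWord (suc n)) → m ≡ n
idmatWord-length-injective {m} {n} eq = suc-injective (m*[1+m]≡n*[1+n]⇒m≡n
  (trans (sym (idmatWord-length m)) (trans (cong suc eq) (idmatWord-length n))))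

idmatWord-long : ∀ {k} → suc k ≤ length (idmatWord (suc k))
idmatWord-long {k} = s≤s⁻¹ (subst (suc (suc k) ≤_) (sym (idmatWord-length k)) (m≤m+n (suc (suc k)) _))

idmatWord-root : ∀ {a k} → a * a ≤ length (idmatWord (suc k)) → a ≤ suc k
idmatWord-root {a} {k} a*a≤n = m*m<n*[1+n]⇒m≤n (subst (a * a <_) (idmatWord-length k) (s≤s a*a≤n))

idmatWord-padded : ∀ j b → ∃₂ λ U V → idmatWord (j + suc (suc b)) ≡ padded U j s1 s0 b V
idmatWord-padded j b
  with xs , ys , rows≡ ← ∈-∃++ (∈-applyUpTo⁺ (wk (j + suc (suc b))) (m<m+n j z<s))
  with U , V , split ← intercalate-split [ s# ] xs (wk (j + suc (suc b)) j) ys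
  = U , V , (begin
      idmatWord k                                      ≡⟨ cong (intercalate [ s# ]) rows≡ ⟩
      intercalate [ s# ] (xs ++ wk k j ∷ ys)           ≡⟨ split ⟩
      U ++ wk k j ++ V
        ≡⟨ cong (λ n → U ++ (R ++ s1 ∷ replicate (n ∸ 1) s0) ++ V) (m+n∸m≡n j (suc (suc b))) ⟩
      U ++ (R ++ s1 ∷ s0 ∷ replicate b s0) ++ V        ≡⟨ cong (U ++_) (++-assoc R _ V) ⟩
      padded U j s1 s0 b V                             ∎)
  where
  open ≡-Reasoning
  k = j + suc (suc b)
  R = replicate j s0

module _ (C : ACA) where
  open ACA C

  iterΔ-local : ∀ τ (c c′ : Config) z z′ → (∀ d → ∣ d ∣ ≤ τ → c (z ℤ.+ d) ≡ c′ (z′ ℤ.+ d)) →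
                iterΔ τ c z ≡ iterΔ τ c′ z′
  iterΔ-local zero c c′ z z′ agree =
    subst₂ (λ x x′ → c x ≡ c′ x′) (ℤP.+-identityʳ z) (ℤP.+-identityʳ z′) (agree (+ 0) z≤n)
  iterΔ-local (suc τ) c c′ z z′ agree =
    δ-cong (neighbour -[1+ 0 ] ≤-refl) (iterΔ-local τ c c′ z z′ λ d ∣d∣≤τ → agree d (m≤n⇒m≤1+n ∣d∣≤τ))
           (neighbour (+ 1) ≤-refl)
    where
    δ-cong : ∀ {l l′ m m′ r r′} → l ≡ l′ → m ≡ m′ → r ≡ r′ → δ l m r ≡ δ l′ m′ r′
    δ-cong refl refl refl = refl

    neighbour : ∀ e → ∣ e ∣ ≤ 1 → iterΔ τ c (z ℤ.+ e) ≡ iterΔ τ c′ (z′ ℤ.+ e)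
    neighbour e ∣e∣≤1 = iterΔ-local τ c c′ (z ℤ.+ e) (z′ ℤ.+ e) λ d ∣d∣≤τ →
      subst₂ (λ x x′ → c x ≡ c′ x′) (sym (ℤP.+-assoc z e d)) (sym (ℤP.+-assoc z′ e d))
        (agree (e ℤ.+ d) (≤-trans (ℤP.∣i+j∣≤∣i∣+∣j∣ e d) (+-mono-≤ ∣e∣≤1 ∣d∣≤τ)))

  accepting-transfer : ∀ τ (c c′ : Config) p →
    (∀ x → 1 < ∣ x ℤ.- p ∣ → c′ x ≡ c x) →
    (∀ x → ∣ x ℤ.- p ∣ ≤ suc (τ + τ) → c′ x ≡ c (x ℤ.- + 1)) →
    AllAccepting (iterΔ τ c) → AllAccepting (iterΔ τ c′)
  accepting-transfer τ c c′ p far near accepting z with ∣ z ℤ.- p ∣ ≤? suc τ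
  ... | yes close =
    subst (λ s → A s ⊎ s ≡ q) (iterΔ-local τ c c′ (z ℤ.- + 1) z shifted) (accepting (z ℤ.- + 1))
    where
    shifted : ∀ d → ∣ d ∣ ≤ τ → c ((z ℤ.- + 1) ℤ.+ d) ≡ c′ (z ℤ.+ d)
    shifted d ∣d∣≤τ = sym (trans
      (near (z ℤ.+ d) (≤-trans (∣[z+d]-p∣≤∣z-p∣+∣d∣ z d p) (+-mono-≤ close ∣d∣≤τ)))
      (cong c (swap-1 z d)))
      where
      swap-1 : ∀ z d → (z ℤ.+ d) ℤ.- + 1 ≡ (z ℤ.- + 1) ℤ.+ d
      swap-1 = solve-∀
  ... | no distant = subst (λ s → A s ⊎ s ≡ q) (iterΔ-local τ c c′ z z unchanged) (accepting z)
    where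
    unchanged : ∀ d → ∣ d ∣ ≤ τ → c (z ℤ.+ d) ≡ c′ (z ℤ.+ d)
    unchanged d ∣d∣≤τ = sym (far (z ℤ.+ d) (+-cancelʳ-≤ τ 2 _ (begin
      suc (suc τ)                        ≤⟨ ≰⇒> distant ⟩
      ∣ z ℤ.- p ∣                        ≤⟨ ∣z-p∣≤∣[z+d]-p∣+∣d∣ z d p ⟩
      ∣ (z ℤ.+ d) ℤ.- p ∣ + ∣ d ∣        ≤⟨ +-monoʳ-≤ _ ∣d∣≤τ ⟩
      ∣ (z ℤ.+ d) ℤ.- p ∣ + τ            ∎)))
      where open ≤-Reasoning

  cellAt-++ : ∀ U Y r → cellAt (U ++ Y) (length U + r) ≡ cellAt Y r
  cellAt-++ []      Y r = refl
  cellAt-++ (_ ∷ U) Y r = cellAt-++ U Y r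

  cellAt-swap : ∀ X x y x′ y′ Z i → i ≢ length X → i ≢ suc (length X) →
                cellAt (X ++ x ∷ y ∷ Z) i ≡ cellAt (X ++ x′ ∷ y′ ∷ Z) i
  cellAt-swap []      x y x′ y′ Z zero          i≢0 _   = contradiction refl i≢0
  cellAt-swap []      x y x′ y′ Z (suc zero)    _   i≢1 = contradiction refl i≢1
  cellAt-swap []      x y x′ y′ Z (suc (suc i)) _   _   = refl
  cellAt-swap (_ ∷ X) x y x′ y′ Z zero          _   _   = refl
  cellAt-swap (_ ∷ X) x y x′ y′ Z (suc i) i≢ i≢′ =
    cellAt-swap X x y x′ y′ Z i (i≢ ∘ cong suc) (i≢′ ∘ cong suc)

  cellAt-zeros : ∀ b V r → r < b → cellAt (replicate b s0 ++ V) r ≡ ι s0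
  cellAt-zeros (suc b) V zero    _         = refl
  cellAt-zeros (suc b) V (suc r) (s≤s r<b) = cellAt-zeros b V r r<b

  cellAt-shift : ∀ j b V r → r ≤ j + b →
    cellAt (replicate j s0 ++ s0 ∷ s1 ∷ replicate b s0 ++ V) (suc r) ≡
    cellAt (replicate j s0 ++ s1 ∷ s0 ∷ replicate b s0 ++ V) r
  cellAt-shift zero          b V zero          _         = refl
  cellAt-shift zero          b V (suc zero)    r<b       = cellAt-zeros b V 0 r<b
  cellAt-shift zero          b V (suc (suc r)) r<b       =
    trans (cellAt-zeros b V (suc r) r<b) (sym (cellAt-zeros b V r (<-trans (n<1+n r) r<b)))
  cellAt-shift (suc zero)    b V zero          _         = refl
  cellAt-shift (suc (suc j)) b V zero          _         = refl
  cellAt-shift (suc j)       b V (suc r)       (s≤s r≤) = cellAt-shift j b V r r≤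

  module _ (U : Word) (j b : ℕ) (V : Word) where
    private
      before after : Word
      before = padded U j s1 s0 b V
      after  = padded U j s0 s1 b V
      p = length U
      R = replicate j s0
      Z = replicate b s0 ++ V

    init-swap-far : ∀ x → 1 < ∣ x ℤ.- + (p + j) ∣ → init after x ≡ init before x
    init-swap-far -[1+ _ ] _   = refl
    init-swap-far (+ i)    gap = subst₂ (λ w w′ → cellAt w i ≡ cellAt w′ i) (++-assoc U R _) (++-assoc U R _)
      (cellAt-swap (U ++ R) s0 s1 s1 s0 Z i
        (λ i≡ → 1<∣m-n∣⇒m≢n gap′ (trans i≡ |U++R|))
        (λ i≡ → 1<∣m-n∣⇒m≢1+n gap′ (trans i≡ (cong suc |U++R|))))
      where
      gap′ : 1 < ℕ.∣ i - (p + j) ∣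
      gap′ = subst (1 <_) (∣+m-+n∣≡∣m-n∣ i (p + j)) gap
      |U++R| : length (U ++ R) ≡ p + j
      |U++R| = trans (length-++ U) (cong (_+_ p) (length-replicate j))

    cellAt-swap-shift : ∀ r → r ≤ j + b → cellAt after (suc (p + r)) ≡ cellAt before (p + r)
    cellAt-swap-shift r r≤ = begin
      cellAt after (suc (p + r))        ≡⟨ cong (cellAt after) (sym (+-suc p r)) ⟩
      cellAt after (p + suc r)          ≡⟨ cellAt-++ U _ (suc r) ⟩
      cellAt (R ++ s0 ∷ s1 ∷ Z) (suc r) ≡⟨ cellAt-shift j b V r r≤ ⟩
      cellAt (R ++ s1 ∷ s0 ∷ Z) r       ≡⟨ cellAt-++ U _ r ⟨
      cellAt before (p + r)             ∎
      where open ≡-Reasoning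

    init-swap-near : ∀ ρ → ρ < j → ρ ≤ suc b → ∀ x → ∣ x ℤ.- + (p + j) ∣ ≤ ρ →
                     init after x ≡ init before (x ℤ.- + 1)
    init-swap-near ρ ρ<j ρ≤1+b -[1+ _ ]  _     = refl
    init-swap-near ρ ρ<j ρ≤1+b (+ zero)  close =
      contradiction (≤-trans (m≤n+m j p) (subst (_≤ ρ) (∣+m-+n∣≡∣m-n∣ 0 (p + j)) close)) (<⇒≱ ρ<j)
    init-swap-near ρ ρ<j ρ≤1+b (+ suc i) close
      with r , r≤j+b , refl ← ∣1+i-[p+j]∣≤ρ⇒i≡p+r {p} i ρ<j ρ≤1+b
                                 (subst (_≤ ρ) (∣+m-+n∣≡∣m-n∣ (suc i) (p + j)) close)
      = cellAt-swap-shift r r≤j+b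

    swap-accepted : ∀ τ → suc (τ + τ) < j → τ + τ ≤ b →
                    AcceptsAt (padded U j s1 s0 b V) τ → AcceptsAt (padded U j s0 s1 b V) τ
    swap-accepted τ 2τ+1<j 2τ≤b = accepting-transfer τ (init before) (init after) (+ (p + j))
      init-swap-far (init-swap-near (suc (τ + τ)) 2τ+1<j (s≤s 2τ≤b))

  no-fast-acceptance : (∀ w → Lang w → IDMAT w) →
                       ∀ {k U j b V} τ → idmatWord (suc k) ≡ padded U j s1 s0 b V →
                       suc (τ + τ) < j → τ + τ ≤ b → ¬ AcceptsAt (idmatWord (suc k)) τ
  no-fast-acceptance sound {k} {U} {j} {b} {V} τ split 2τ+1<j 2τ≤b accepted
    with sound (padded U j s0 s1 b V)
               (padded-nonempty U j s0 s1 b V , τ ,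
                swap-accepted U j b V τ 2τ+1<j 2τ≤b (subst (λ w → AcceptsAt w τ) split accepted))
  ... | zero   , () , _
  ... | suc k′ , _  , swapped≡ =
    contradiction (padded-injective U j b V (trans swapped≡ (trans (cong (idmatWord ∘ suc) k′≡k) split))) λ ()
    where
    k′≡k : k′ ≡ k
    k′≡k = idmatWord-length-injective
      (trans (cong length (sym swapped≡)) (trans (padded-length U j s0 s1 s1 s0 b V) (cong length (sym split))))

proposition3 : (t : ℕ → ℕ) → LittleOSqrt t → ¬ InACA t IDMAT
proposition3 t t∈o[√n] (C , same-language , fast) =
  let N , small = t∈o[√n] 8 (s≤s z≤n)
      w = idmatWord (8 + N)
      T = t (length w)
      τ , τ≤T , accepted = fast w (proj₂ (same-language w) (8 + N , s≤s z≤n , refl))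
      8T≤k = idmatWord-root {k = 7 + N} (small (length w) (≤-trans (m≤n+m N 8) idmatWord-long))
      b , 2T≤b , k≡ = 8*m≤n⇒n≡2+2m+2+o T (8 + N) 8T≤k (m≤m+n 8 N)
      U , V , split = idmatWord-padded (suc (suc (T + T))) b
      2τ≤2T = +-mono-≤ τ≤T τ≤T
  in no-fast-acceptance C (proj₁ ∘ same-language) {k = 7 + N} τ (trans (cong idmatWord k≡) split)
       (s≤s (s≤s 2τ≤2T)) (≤-trans 2τ≤2T 2T≤b) accepted
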